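{- Let $p$ be a prime and $m$ a positive integer with $\gcd(p,m)=1$. Assume that $m_0:=\gcd(p-1,m)\geq 3$ and let $d_0=(p-1)/m_0$. Then every integer $n\geq d_0+1$ lies in $W_p(m_0)$, and $W_p(m_0)\subseteq W_p(m)$.
   Context: For a prime $p$ and a positive integer $m$, $W_p(m)$ denotes the set of integers $n\geq 0$ for which there exist $\alpha_1,\dots,\alpha_n\in\overline{\mathbb{F}}_p$ with $\alpha_i^m=1$ for all $i$ (repetitions allowed) and $\alpha_1+\cdots+\alpha_n=0$. -}

module Defs where

open import Level using (0ℓ)
open import Data.Nat.Base using (ℕ; zero; suc)
open import Data.Fin.Base using (Fin)
open import Data.List.Base using (List; []; _∷_; map)
open import Data.List.Relation.Unary.Any using (Any)
open import Data.Product.Base using (Σ; ∃; _×_)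
open import Relation.Nullary.Negation using (¬_)
open import Algebra.Bundles using (CommutativeRing; Semiring)
import Algebra.Definitions.RawSemiring as RS
import Data.List.Base

module _ (K : CommutativeRing 0ℓ 0ℓ) where
  open CommutativeRing K

  evalPoly : List Carrier → Carrier → Carrier
  evalPoly []       x = 0#
  evalPoly (a ∷ as) x = a + x * evalPoly as x

record IsAlgClosureOfFp (p : ℕ) (K : CommutativeRing 0ℓ 0ℓ) : Set where
  open CommutativeRing K
  open RS (Semiring.rawSemiring semiring) using () renaming (_×_ to _·_)
  field
    nontrivial  : ¬ (1# ≈ 0#)
    inverses    : ∀ x → ¬ (x ≈ 0#) → ∃ λ y → x * y ≈ 1#
    characteristic : p · 1# ≈ 0#
    -- algebraically closed: every polynomial a + cs·X + … + c·X^(1+|cs|)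
    -- of degree ≥ 1 with nonzero leading coefficient c has a root
    algClosed   : ∀ (a : Carrier) (cs : List Carrier) (c : Carrier) →
                  ¬ (c ≈ 0#) →
                  ∃ λ x → evalPoly K (a ∷ (cs Data.List.Base.++ (c ∷ []))) x ≈ 0#
    -- algebraic over the prime field: every element is a root of a
    -- nonzero polynomial with coefficients in F_p (images of naturals)
    algebraic   : ∀ x → ∃ λ (cs : List ℕ) →
                  Any (λ c → ¬ (c · 1# ≈ 0#)) cs ×
                  evalPoly K (map (λ c → c · 1#) cs) x ≈ 0#

-- n ∈ W_p(m), computed in a given algebraic closure K of F_p:
-- there are α₁,…,αₙ ∈ K with αᵢ^m = 1 and α₁ + ⋯ + αₙ = 0.
InW : (K : CommutativeRing 0ℓ 0ℓ) → (m n : ℕ) → Set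
InW K m n = Σ (Fin n → Carrier) λ α → (∀ i → α i ^ m ≈ 1#) × sum α ≈ 0#
  where
  open CommutativeRing K
  open RS (Semiring.rawSemiring semiring) using (_^_; sum)

{-# OPTIONS --safe #-}
module Submission where

-- Let μ ⊆ 𝔽_p be the group of m₀-th roots of unity and Sₖ ⊆ 𝔽_p the set of sums of k elements of μ,
-- so S₀ = {0} and Sₖ₊₁ = Sₖ + μ. Each Sₖ is stable under multiplication by μ, so Sₖ ∖ {0} is a union
-- of cosets of μ. If Sₖ₊₁ ≠ 𝔽_p then |Sₖ₊₁| ≥ |Sₖ| + 2: the power sums Σ x and Σ x² vanish over every
-- μ-stable set (μ contains some t with t² ≠ 1 as m₀ ≥ 3) and equal |Sₖ| over Sₖ + 1 ⊆ Sₖ₊₁, which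
-- leaves no room for Sₖ₊₁ ∖ (Sₖ + 1) to have fewer than two elements. Hence |Sₖ ∖ {0}| grows by
-- |μ| ≥ m₀ at each step until Sₖ ⊇ 𝔽_p^×, which happens by k = d₀; then -1 ∈ Sₖ and 0 ∈ Sₖ₊₁.
-- The bound |μ| ≥ m₀ holds because, by Fermat, every nonzero x ∉ μ is a root of Σ_{i<d₀} x^{m₀ i}.
-- Finally W_p(m₀) ⊆ W_p(m) since m₀ ∣ m.

open import Defs
open import Level using (Level; 0ℓ; _⊔_)
open import Data.Nat.Base as ℕ using (ℕ; zero; suc; _≤_; _<_; z<s)
import Data.Nat.Properties as ℕ
open import Data.Nat.DivMod using (_%_; _/_; m%n<n; m≡m%n+[m/n]*n)
open import Data.Nat.Primality using (Prime)
open import Data.Nat.Divisibility using (_∣_; divides; _∣0; ∣-refl; ∣m∣n⇒∣m+n)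
open import Data.Nat.Coprimality using (coprime-Bézout; prime⇒coprime)
open import Data.Nat.GCD using (module Bézout)
open import Data.Fin.Base as Fin using (Fin; toℕ; fromℕ<)
open import Data.Fin.Properties as Fin using (toℕ-fromℕ<; toℕ-injective; toℕ<n)
open import Data.Fin.Permutation using (Permutation; permutation; _⟨$⟩ʳ_)
open import Data.Bool.Base using (Bool; true; false; not; _∧_; _∨_; if_then_else_)
open import Data.Bool.Properties using (∧-identityʳ; ∧-zeroʳ; ∨-zeroʳ; ∧-conicalˡ; ∧-conicalʳ; not-injective)
open import Data.Empty using (⊥-elim)
open import Data.Sum.Base using (_⊎_; inj₁; inj₂)
open import Data.Integer.Base as ℤ using (ℤ; +_; -[1+_]; 0ℤ; 1ℤ; sign; ∣_∣; _◃_)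
import Data.Integer.Properties as ℤ
open import Data.Sign.Base as Sign using (Sign)
open import Data.Maybe.Base using (Maybe; just; nothing)
open import Relation.Nullary using (¬_; yes; no; does)
open import Relation.Nullary.Decidable using (dec-true; dec-false)
open import Data.Product.Base using (∃; _×_; _,_; proj₁; proj₂)
open import Function.Base using (_∘_)
open import Data.Vec.Functional using (_∷_)
open import Relation.Binary.PropositionalEquality as ≡ using (_≡_; _≢_)
open import Algebra.Bundles using (CommutativeRing; CommutativeMonoid)
import Algebra.Properties.Ring as RingProperties
import Algebra.Properties.CommutativeSemigroup as CommutativeSemigroupProperties
import Algebra.Properties.CommutativeMonoid.Sum as CommutativeMonoidSum
import Algebra.Properties.CommutativeSemiring.Exp as CommutativeSemiringExp
import Algebra.Properties.Monoid.Mult as MonoidMult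
import Algebra.Properties.Monoid.Mult.TCOptimised as MonoidMultTCO
import Algebra.Properties.Semiring.Mult as SemiringMult
import Algebra.Properties.Semiring.Mult.TCOptimised as SemiringMultTCO
import Algebra.Solver.Ring
import Algebra.Solver.Ring.AlmostCommutativeRing as ACR
import Relation.Binary.Reasoning.Setoid as SetoidReasoning

module IntegerRingSolver {c ℓ : Level} (R : CommutativeRing c ℓ) where
  open CommutativeRing R
  open RingProperties ring using (-0#≈0#; -‿involutive; -‿+-comm; -‿distribˡ-*)
  open MonoidMultTCO +-monoid using (×-homo-+; 1+×) renaming (_×_ to _·_)
  open SemiringMultTCO semiring using (×1-homo-*)
  open CommutativeSemigroupProperties +-commutativeSemigroup using () renaming (interchange to +-interchange)
  open CommutativeSemigroupProperties *-commutativeSemigroup using () renaming (interchange to *-interchange)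
  open SetoidReasoning setoid

  private
    -- The optimised multiplication makes con 1ℤ evaluate to 1# itself, so solved equations mention 1#.
    fromℤ : ℤ → Carrier
    fromℤ (+ n) = n · 1#
    fromℤ -[1+ n ] = - (suc n · 1#)

    sgn : Sign → Carrier
    sgn Sign.+ = 1#
    sgn Sign.- = - 1#

    sgn-homo : ∀ s t → sgn (s Sign.* t) ≈ sgn s * sgn t
    sgn-homo Sign.+ t = sym (*-identityˡ _)
    sgn-homo Sign.- Sign.+ = sym (*-identityʳ _)
    sgn-homo Sign.- Sign.- = begin
      1#            ≈⟨ -‿involutive 1# ⟨
      - (- 1#)      ≈⟨ -‿cong (*-identityˡ (- 1#)) ⟨
      - (1# * - 1#) ≈⟨ -‿distribˡ-* 1# (- 1#) ⟩
      - 1# * - 1#   ∎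

    ◃-homo : ∀ s n → fromℤ (s ◃ n) ≈ sgn s * (n · 1#)
    ◃-homo s zero = sym (zeroʳ _)
    ◃-homo Sign.+ (suc n) = sym (*-identityˡ _)
    ◃-homo Sign.- (suc n) = trans (-‿cong (sym (*-identityˡ _))) (-‿distribˡ-* 1# _)

    fromℤ-sign-abs : ∀ i → fromℤ i ≈ sgn (sign i) * (∣ i ∣ · 1#)
    fromℤ-sign-abs i = trans (reflexive (≡.cong fromℤ (≡.sym (ℤ.◃-inverse i)))) (◃-homo (sign i) ∣ i ∣)

    ⊖-homo : ∀ m n → fromℤ (m ℤ.⊖ n) ≈ m · 1# - n · 1#
    ⊖-homo m zero = sym (trans (+-congˡ -0#≈0#) (+-identityʳ _))
    ⊖-homo zero (suc n) = sym (+-identityˡ _)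
    ⊖-homo (suc m) (suc n) = begin
      fromℤ (suc m ℤ.⊖ suc n)               ≡⟨ ≡.cong fromℤ (ℤ.[1+m]⊖[1+n]≡m⊖n m n) ⟩
      fromℤ (m ℤ.⊖ n)                       ≈⟨ ⊖-homo m n ⟩
      m · 1# - n · 1#                       ≈⟨ +-identityˡ _ ⟨
      0# + (m · 1# - n · 1#)                ≈⟨ +-congʳ (-‿inverseʳ 1#) ⟨
      (1# - 1#) + (m · 1# - n · 1#)         ≈⟨ +-interchange 1# (- 1#) (m · 1#) (- (n · 1#)) ⟩
      (1# + m · 1#) + (- 1# - n · 1#)       ≈⟨ +-cong (1+× m 1#) (trans (-‿cong (1+× n 1#)) (sym (-‿+-comm 1# (n · 1#)))) ⟨
      suc m · 1# - suc n · 1#               ∎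

    +-homo : ∀ i j → fromℤ (i ℤ.+ j) ≈ fromℤ i + fromℤ j
    +-homo -[1+ m ] -[1+ n ] = begin
      - (suc (suc (m ℕ.+ n)) · 1#)      ≡⟨ ≡.cong (λ k → - (suc k · 1#)) (ℕ.+-suc m n) ⟨
      - ((suc m ℕ.+ suc n) · 1#)        ≈⟨ -‿cong (×-homo-+ 1# (suc m) (suc n)) ⟩
      - (suc m · 1# + suc n · 1#)       ≈⟨ -‿+-comm _ _ ⟨
      - (suc m · 1#) + - (suc n · 1#)   ∎
    +-homo -[1+ m ] (+ n) = trans (⊖-homo n (suc m)) (+-comm _ _)
    +-homo (+ m) -[1+ n ] = ⊖-homo m (suc n)
    +-homo (+ m) (+ n) = ×-homo-+ 1# m n

    *-homo : ∀ i j → fromℤ (i ℤ.* j) ≈ fromℤ i * fromℤ j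
    *-homo i j = begin
      fromℤ (sign i Sign.* sign j ◃ ∣ i ∣ ℕ.* ∣ j ∣)
        ≈⟨ ◃-homo (sign i Sign.* sign j) (∣ i ∣ ℕ.* ∣ j ∣) ⟩
      sgn (sign i Sign.* sign j) * ((∣ i ∣ ℕ.* ∣ j ∣) · 1#)
        ≈⟨ *-cong (sgn-homo (sign i) (sign j)) (×1-homo-* ∣ i ∣ ∣ j ∣) ⟩
      (sgn (sign i) * sgn (sign j)) * ((∣ i ∣ · 1#) * (∣ j ∣ · 1#))
        ≈⟨ *-interchange _ _ _ _ ⟩
      (sgn (sign i) * (∣ i ∣ · 1#)) * (sgn (sign j) * (∣ j ∣ · 1#))
        ≈⟨ *-cong (fromℤ-sign-abs i) (fromℤ-sign-abs j) ⟨
      fromℤ i * fromℤ j ∎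

    -‿homo : ∀ i → fromℤ (ℤ.- i) ≈ - fromℤ i
    -‿homo -[1+ n ] = sym (-‿involutive _)
    -‿homo (+ zero) = sym -0#≈0#
    -‿homo (+ suc n) = refl

    almostCommutativeRing : ACR.AlmostCommutativeRing c ℓ
    almostCommutativeRing = ACR.fromCommutativeRing R

    homomorphism : ℤ.+-*-rawRing ACR.-Raw-AlmostCommutative⟶ almostCommutativeRing
    homomorphism = record
      { ⟦_⟧ = fromℤ ; +-homo = +-homo ; *-homo = *-homo ; -‿homo = -‿homo
      ; 0-homo = refl ; 1-homo = refl }

    coefficient≟ : ∀ i j → Maybe (fromℤ i ≈ fromℤ j)
    coefficient≟ i j with i ℤ.≟ j
    ... | yes ≡.refl = just refl
    ... | no _ = nothing

  open Algebra.Solver.Ring ℤ.+-*-rawRing almostCommutativeRing homomorphism coefficient≟ public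
    using (solve; _:=_; _:+_; _:*_; _:-_; :-_; con)

record IsField {c ℓ : Level} (K : CommutativeRing c ℓ) : Set (c ⊔ ℓ) where
  open CommutativeRing K
  field
    1≉0     : ¬ 1# ≈ 0#
    inverse : ∀ x → ¬ x ≈ 0# → ∃ λ y → x * y ≈ 1#

record IsFieldOfCharacteristic {c ℓ : Level} (p : ℕ) (K : CommutativeRing c ℓ) : Set (c ⊔ ℓ) where
  open CommutativeRing K
  open MonoidMult +-monoid using () renaming (_×_ to _·_)
  field
    isField : IsField K
    char    : p · 1# ≈ 0#
  open IsField isField public

module FieldProperties {c ℓ : Level} (K : CommutativeRing c ℓ) (K-field : IsField K) where
  open CommutativeRing K
  open IsField K-field
  open RingProperties ring using (x∙y⁻¹≈ε⇒x≈y; x≈y⇒x∙y⁻¹≈ε; -‿distribʳ-*)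
  module Π = CommutativeMonoidSum *-commutativeMonoid
  open SetoidReasoning setoid

  x*y≈0⇒y≈0 : ∀ {x y} → ¬ x ≈ 0# → x * y ≈ 0# → y ≈ 0#
  x*y≈0⇒y≈0 {x} {y} x≉0 xy≈0 with inverse x x≉0
  ... | x⁻¹ , xx⁻¹≈1 = begin
    y              ≈⟨ *-identityˡ y ⟨
    1# * y         ≈⟨ *-congʳ xx⁻¹≈1 ⟨
    (x * x⁻¹) * y  ≈⟨ *-congʳ (*-comm x x⁻¹) ⟩
    (x⁻¹ * x) * y  ≈⟨ *-assoc x⁻¹ x y ⟩
    x⁻¹ * (x * y)  ≈⟨ *-congˡ xy≈0 ⟩
    x⁻¹ * 0#       ≈⟨ zeroʳ x⁻¹ ⟩
    0#             ∎

  *-≉0 : ∀ {x y} → ¬ x ≈ 0# → ¬ y ≈ 0# → ¬ x * y ≈ 0#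
  *-≉0 x≉0 y≉0 xy≈0 = y≉0 (x*y≈0⇒y≈0 x≉0 xy≈0)

  *-cancelˡ : ∀ {x y z} → ¬ x ≈ 0# → x * y ≈ x * z → y ≈ z
  *-cancelˡ {x} {y} {z} x≉0 xy≈xz = x∙y⁻¹≈ε⇒x≈y y z (x*y≈0⇒y≈0 x≉0 (begin
    x * (y - z)      ≈⟨ distribˡ x y (- z) ⟩
    x * y + x * - z  ≈⟨ +-congˡ (-‿distribʳ-* x z) ⟨
    x * y - x * z    ≈⟨ x≈y⇒x∙y⁻¹≈ε xy≈xz ⟩
    0#               ∎))

  product-≉0 : ∀ {n} (f : Fin n → Carrier) → (∀ i → ¬ f i ≈ 0#) → ¬ Π.sum f ≈ 0#
  product-≉0 {zero} f _ = 1≉0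
  product-≉0 {suc n} f f≉0 = *-≉0 (f≉0 Fin.zero) (product-≉0 (f ∘ Fin.suc) (f≉0 ∘ Fin.suc))

module Exponentiation {c ℓ : Level} (K : CommutativeRing c ℓ) where
  open CommutativeRing K
  open CommutativeSemiringExp commutativeSemiring using (_^_; ^-congˡ; ^-assocʳ)
  open IntegerRingSolver K using (solve; _:=_; _:+_; _:*_; _:-_; con)
  open SetoidReasoning setoid

  1#^≈1# : ∀ n → 1# ^ n ≈ 1#
  1#^≈1# zero = refl
  1#^≈1# (suc n) = trans (*-identityˡ _) (1#^≈1# n)

  0#^≈0# : ∀ {n} → 0 < n → 0# ^ n ≈ 0#
  0#^≈0# {suc n} _ = zeroˡ _

  ^≈1-∣ : ∀ {a b x} → a ∣ b → x ^ a ≈ 1# → x ^ b ≈ 1#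
  ^≈1-∣ {a} {x = x} (divides c ≡.refl) x^a≈1 =
    trans (reflexive (≡.cong (x ^_) (ℕ.*-comm c a))) (trans (sym (^-assocʳ x a c)) (trans (^-congˡ c x^a≈1) (1#^≈1# c)))

  geometric : ℕ → Carrier → Carrier
  geometric zero y = 1#
  geometric (suc n) y = 1# + y * geometric n y

  geometric-identity : ∀ n y → (y - 1#) * geometric n y ≈ y ^ suc n - 1#
  geometric-identity zero y = solve 1 (λ y → (y :- con 1ℤ) :* con 1ℤ := y :* con 1ℤ :- con 1ℤ) refl y
  geometric-identity (suc n) y = begin
    (y - 1#) * (1# + y * geometric n y)
      ≈⟨ solve 2 (λ y g → (y :- con 1ℤ) :* (con 1ℤ :+ y :* g) := (y :- con 1ℤ) :+ y :* ((y :- con 1ℤ) :* g)) refl y (geometric n y) ⟩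
    (y - 1#) + y * ((y - 1#) * geometric n y)  ≈⟨ +-congˡ (*-congˡ (geometric-identity n y)) ⟩
    (y - 1#) + y * (y ^ suc n - 1#)
      ≈⟨ solve 2 (λ y z → (y :- con 1ℤ) :+ y :* (z :- con 1ℤ) := y :* z :- con 1ℤ) refl y (y ^ suc n) ⟩
    y * y ^ suc n - 1#                         ∎

infix 4 _==_

_==_ : ∀ {n} → Fin n → Fin n → Bool
i == j = does (i Fin.≟ j)

==-refl : ∀ {n} (i : Fin n) → (i == i) ≡ true
==-refl i = dec-true (i Fin.≟ i) ≡.refl

==⇒≡ : ∀ {n} {i j : Fin n} → (i == j) ≡ true → i ≡ j
==⇒≡ {i = i} {j} i==j with i Fin.≟ j
... | yes i≡j = i≡j

≢⇒==false : ∀ {n} {i j : Fin n} → i ≢ j → (i == j) ≡ false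
≢⇒==false {i = i} {j} = dec-false (i Fin.≟ j)

==false⇒≢ : ∀ {n} {i j : Fin n} → (i == j) ≡ false → i ≢ j
==false⇒≢ {i = i} i==j≡false ≡.refl with () ← ≡.trans (≡.sym i==j≡false) (==-refl i)

anyᵇ : ∀ {n} → (Fin n → Bool) → Bool
anyᵇ {zero} f = false
anyᵇ {suc n} f = f Fin.zero ∨ anyᵇ (f ∘ Fin.suc)

anyᵇ-intro : ∀ {n} (f : Fin n → Bool) i → f i ≡ true → anyᵇ f ≡ true
anyᵇ-intro f Fin.zero fi rewrite fi = ≡.refl
anyᵇ-intro f (Fin.suc i) fi = ≡.trans (≡.cong (f Fin.zero ∨_) (anyᵇ-intro (f ∘ Fin.suc) i fi)) (∨-zeroʳ (f Fin.zero))

anyᵇ-elim : ∀ {n} (f : Fin n → Bool) → anyᵇ f ≡ true → ∃ λ i → f i ≡ true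
anyᵇ-elim {suc n} f any≡true with f Fin.zero in f0
... | true = Fin.zero , f0
... | false with anyᵇ-elim (f ∘ Fin.suc) any≡true
...   | i , fi = Fin.suc i , fi

module SumOver {a ℓ : Level} (M : CommutativeMonoid a ℓ) where
  open CommutativeMonoid M
  open CommutativeMonoidSum M using (sum; sum-cong-≋; sum-permute; ∑-distrib-+)

  sumOver : ∀ {n} → (Fin n → Bool) → (Fin n → Carrier) → Carrier
  sumOver X f = sum (λ i → if X i then f i else ε)

  sumOver-cong : ∀ {n} (X Y : Fin n → Bool) f g → (∀ i → X i ≡ Y i) →
                 (∀ i → X i ≡ true → f i ≈ g i) → sumOver X f ≈ sumOver Y g
  sumOver-cong X Y f g X≗Y f≈g = sum-cong-≋ pointwise
    where
    pointwise : ∀ i → (if X i then f i else ε) ≈ (if Y i then g i else ε)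
    pointwise i with X i | Y i | X≗Y i | f≈g i
    ... | true  | true  | _ | fi≈gi = fi≈gi ≡.refl
    ... | false | false | _ | _     = refl

  sumOver-congˡ : ∀ {n} (X Y : Fin n → Bool) f → (∀ i → X i ≡ Y i) → sumOver X f ≈ sumOver Y f
  sumOver-congˡ X Y f X≗Y = sumOver-cong X Y f f X≗Y (λ _ _ → refl)

  sumOver-congʳ : ∀ {n} (X : Fin n → Bool) f g → (∀ i → X i ≡ true → f i ≈ g i) → sumOver X f ≈ sumOver X g
  sumOver-congʳ X f g = sumOver-cong X X f g (λ _ → ≡.refl)

  sumOver-permute : ∀ {n} (X : Fin n → Bool) f (π : Permutation n n) →
                    sumOver X f ≈ sumOver (X ∘ (π ⟨$⟩ʳ_)) (f ∘ (π ⟨$⟩ʳ_))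
  sumOver-permute X f π = sum-permute (λ i → if X i then f i else ε) π

  sumOver-∙ : ∀ {n} (X : Fin n → Bool) f g → sumOver X (λ i → f i ∙ g i) ≈ sumOver X f ∙ sumOver X g
  sumOver-∙ X f g = trans (sum-cong-≋ pointwise)
    (∑-distrib-+ (λ i → if X i then f i else ε) (λ i → if X i then g i else ε))
    where
    pointwise : ∀ i → (if X i then f i ∙ g i else ε) ≈ (if X i then f i else ε) ∙ (if X i then g i else ε)
    pointwise i with X i
    ... | true  = refl
    ... | false = sym (identityˡ ε)

  sumOver-split : ∀ {n} (X Y : Fin n → Bool) f →
                  sumOver X f ≈ sumOver (λ i → X i ∧ Y i) f ∙ sumOver (λ i → X i ∧ not (Y i)) f
  sumOver-split X Y f = trans (sum-cong-≋ pointwise)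
    (∑-distrib-+ (λ i → if X i ∧ Y i then f i else ε) (λ i → if X i ∧ not (Y i) then f i else ε))
    where
    pointwise : ∀ i → (if X i then f i else ε) ≈
                      (if X i ∧ Y i then f i else ε) ∙ (if X i ∧ not (Y i) then f i else ε)
    pointwise i with X i | Y i
    ... | true  | true  = sym (identityʳ (f i))
    ... | true  | false = sym (identityˡ (f i))
    ... | false | _     = sym (identityˡ ε)

  sumOver-⊆-split : ∀ {n} {X Y : Fin n → Bool} f → (∀ i → Y i ≡ true → X i ≡ true) →
                    sumOver X f ≈ sumOver Y f ∙ sumOver (λ i → X i ∧ not (Y i)) f
  sumOver-⊆-split {X = X} {Y} f Y⊆X =
    trans (sumOver-split X Y f) (∙-congʳ (sumOver-congˡ (λ i → X i ∧ Y i) Y f X∧Y≗Y))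
    where
    X∧Y≗Y : ∀ i → (X i ∧ Y i) ≡ Y i
    X∧Y≗Y i with Y i in Yi
    ... | true rewrite Y⊆X i Yi = ≡.refl
    ... | false = ∧-zeroʳ (X i)

  sumOver-∅ : ∀ {n} {X : Fin n → Bool} f → (∀ i → X i ≡ false) → sumOver X f ≈ ε
  sumOver-∅ {zero} f _ = refl
  sumOver-∅ {suc n} {X} f X≡false rewrite X≡false Fin.zero =
    trans (identityˡ _) (sumOver-∅ (f ∘ Fin.suc) (X≡false ∘ Fin.suc))

module ℕΣ = SumOver ℕ.+-0-commutativeMonoid

count : ∀ {n} → (Fin n → Bool) → ℕ
count X = ℕΣ.sumOver X (λ _ → 1)

count-cong : ∀ {n} {X Y : Fin n → Bool} → (∀ i → X i ≡ Y i) → count X ≡ count Y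
count-cong {X = X} {Y} X≗Y = ℕΣ.sumOver-congˡ X Y (λ _ → 1) X≗Y

count-split : ∀ {n} (X Y : Fin n → Bool) →
              count X ≡ count (λ i → X i ∧ Y i) ℕ.+ count (λ i → X i ∧ not (Y i))
count-split X Y = ℕΣ.sumOver-split X Y (λ _ → 1)

count-permute : ∀ {n} (X : Fin n → Bool) (π : Permutation n n) → count X ≡ count (X ∘ (π ⟨$⟩ʳ_))
count-permute X π = ℕΣ.sumOver-permute X (λ _ → 1) π

count-mono : ∀ {n} {X Y : Fin n → Bool} → (∀ i → X i ≡ true → Y i ≡ true) → count X ≤ count Y
count-mono {zero} _ = ℕ.z≤n
count-mono {suc n} {X} {Y} X⊆Y with X Fin.zero in X0 | Y Fin.zero in Y0
... | false | false = count-mono (X⊆Y ∘ Fin.suc)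
... | false | true  = ℕ.m≤n⇒m≤1+n (count-mono (X⊆Y ∘ Fin.suc))
... | true  | true  = ℕ.s≤s (count-mono (X⊆Y ∘ Fin.suc))
... | true  | false with () ← ≡.trans (≡.sym Y0) (X⊆Y Fin.zero X0)

∈⇒count>0 : ∀ {n} {X : Fin n → Bool} {i} → X i ≡ true → 0 < count X
∈⇒count>0 {suc n} {X} {Fin.zero} Xi rewrite Xi = z<s
∈⇒count>0 {suc n} {X} {Fin.suc i} Xi = ℕ.<-≤-trans (∈⇒count>0 {X = X ∘ Fin.suc} Xi) (ℕ.m≤n+m _ _)

count≡0⇒∉ : ∀ {n} {X : Fin n → Bool} → count X ≡ 0 → ∀ i → X i ≡ false
count≡0⇒∉ {X = X} count≡0 i with X i in Xi
... | false = ≡.refl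
... | true  = ⊥-elim (ℕ.<⇒≢ (∈⇒count>0 {X = X} Xi) (≡.sym count≡0))

count>0⇒∈ : ∀ {n} (X : Fin n → Bool) → 0 < count X → ∃ λ i → X i ≡ true
count>0⇒∈ {suc n} X count>0 with X Fin.zero in X0
... | true  = Fin.zero , X0
... | false with count>0⇒∈ (X ∘ Fin.suc) count>0
...   | i , Xi = Fin.suc i , Xi

count-all : ∀ n → count {n} (λ _ → true) ≡ n
count-all zero = ≡.refl
count-all (suc n) = ≡.cong suc (count-all n)

count-== : ∀ {n} (y : Fin n) → count (_== y) ≡ 1
count-== {suc n} Fin.zero = ≡.cong suc
  (ℕΣ.sumOver-∅ {n} {X = λ i → Fin.suc i == Fin.zero} (λ _ → 1) (λ i → ≢⇒==false {i = Fin.suc i} {j = Fin.zero} λ ()))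
count-== {suc n} (Fin.suc y) = count-== y

count-≢ : ∀ {n} (y : Fin (suc n)) → count (λ i → not (i == y)) ≡ n
count-≢ {n} y = ℕ.suc-injective (begin
  suc (count (λ i → not (i == y)))                            ≡⟨ ≡.cong (ℕ._+ count (λ i → not (i == y))) (count-== y) ⟨
  count (_== y) ℕ.+ count (λ i → not (i == y))                ≡⟨ count-split (λ _ → true) (_== y) ⟨
  count {suc n} (λ _ → true)                                   ≡⟨ count-all (suc n) ⟩
  suc n                                                        ∎)
  where open ≡.≡-Reasoning

count-⊆-split : ∀ {n} {X Y : Fin n → Bool} → (∀ i → Y i ≡ true → X i ≡ true) →
                count X ≡ count Y ℕ.+ count (λ i → X i ∧ not (Y i))
count-⊆-split = ℕΣ.sumOver-⊆-split (λ _ → 1)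

count-remove : ∀ {n} {X : Fin n → Bool} {r} → X r ≡ true →
               count X ≡ suc (count (λ i → X i ∧ not (i == r)))
count-remove {X = X} {r} Xr = ≡.trans (count-⊆-split {X = X} {Y = _== r} r⊆X)
  (≡.cong (ℕ._+ count (λ i → X i ∧ not (i == r))) (count-== r))
  where
  r⊆X : ∀ i → (i == r) ≡ true → X i ≡ true
  r⊆X i i==r rewrite ==⇒≡ {i = i} {j = r} i==r = Xr

count-⊆-pair : ∀ {n} {X : Fin n → Bool} a b → (∀ i → X i ≡ true → i ≡ a ⊎ i ≡ b) → count X ≤ 2
count-⊆-pair {X = X} a b X⊆ab = ℕ.≤-trans (ℕ.≤-reflexive (count-split X (_== a)))
  (ℕ.+-mono-≤ (ℕ.≤-trans (count-mono {Y = _== a} (λ i → ∧-conicalʳ (X i) _)) (ℕ.≤-reflexive (count-== a)))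
              (ℕ.≤-trans (count-mono {Y = _== b} X∖a⊆b) (ℕ.≤-reflexive (count-== b))))
  where
  X∖a⊆b : ∀ i → (X i ∧ not (i == a)) ≡ true → (i == b) ≡ true
  X∖a⊆b i X∖a with X⊆ab i (∧-conicalˡ (X i) _ X∖a)
  ... | inj₁ ≡.refl = ⊥-elim (==false⇒≢ {i = i} {j = i} (not-injective (∧-conicalʳ (X i) _ X∖a)) ≡.refl)
  ... | inj₂ ≡.refl = ==-refl i

+-next-multiple : ∀ {m a b} → m ∣ a → m ∣ b → a < b → a ℕ.+ m ≤ b
+-next-multiple {m} (divides x ≡.refl) (divides y ≡.refl) xm<ym =
  ℕ.≤-trans (ℕ.≤-reflexive (ℕ.+-comm (x ℕ.* m) m)) (ℕ.*-monoˡ-≤ m (ℕ.*-cancelʳ-< _ x y xm<ym))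

+-⊓-≤ : ∀ m a q → (m ℕ.+ a) ℕ.⊓ q ≤ m ℕ.+ a ℕ.⊓ q
+-⊓-≤ m a q = ℕ.≤-trans (ℕ.⊓-monoʳ-≤ (m ℕ.+ a) (ℕ.m≤n+m q m)) (ℕ.≤-reflexive (≡.sym (ℕ.+-distribˡ-⊓ m a q)))

module RingSums {c ℓ : Level} (K : CommutativeRing c ℓ) where
  open CommutativeRing K
  open MonoidMult +-monoid using () renaming (_×_ to _·_)
  open SumOver +-commutativeMonoid public

  sumOver-*ˡ : ∀ {n} (X : Fin n → Bool) x f → sumOver X (λ i → x * f i) ≈ x * sumOver X f
  sumOver-*ˡ {zero} X x f = sym (zeroʳ x)
  sumOver-*ˡ {suc n} X x f with X Fin.zero
  ... | true  = trans (+-congˡ (sumOver-*ˡ (X ∘ Fin.suc) x (f ∘ Fin.suc))) (sym (distribˡ x _ _))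
  ... | false = trans (+-cong (sym (zeroʳ x)) (sumOver-*ˡ (X ∘ Fin.suc) x (f ∘ Fin.suc))) (sym (distribˡ x _ _))

  count-·1 : ∀ {n} (X : Fin n → Bool) → count X · 1# ≈ sumOver X (λ _ → 1#)
  count-·1 {zero} X = refl
  count-·1 {suc n} X with X Fin.zero
  ... | true  = +-congˡ (count-·1 (X ∘ Fin.suc))
  ... | false = trans (count-·1 (X ∘ Fin.suc)) (sym (+-identityˡ _))

  sumOver-square : ∀ {n} {X : Fin n → Bool} f → count X ≤ 1 →
                   sumOver X (λ i → f i * f i) ≈ sumOver X f * sumOver X f
  sumOver-square {zero} f _ = sym (zeroˡ 0#)
  sumOver-square {suc n} {X} f count≤1 with X Fin.zero
  ... | true = begin
      f₀ * f₀ + sumOver X₊ (λ i → f₊ i * f₊ i)  ≈⟨ +-congˡ (sumOver-∅ _ X₊-empty) ⟩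
      f₀ * f₀ + 0#                               ≈⟨ +-identityʳ _ ⟩
      f₀ * f₀                                    ≈⟨ *-cong (+-identityʳ f₀) (+-identityʳ f₀) ⟨
      (f₀ + 0#) * (f₀ + 0#)                      ≈⟨ *-cong (+-congˡ Σf₊≈0) (+-congˡ Σf₊≈0) ⟨
      (f₀ + sumOver X₊ f₊) * (f₀ + sumOver X₊ f₊) ∎
    where
    open SetoidReasoning setoid
    X₊ : Fin n → Bool
    X₊ = X ∘ Fin.suc
    f₀ : Carrier
    f₀ = f Fin.zero
    f₊ : Fin n → Carrier
    f₊ = f ∘ Fin.suc
    X₊-empty : ∀ i → X₊ i ≡ false
    X₊-empty = count≡0⇒∉ (ℕ.n≤0⇒n≡0 (ℕ.≤-pred count≤1))
    Σf₊≈0 : sumOver X₊ f₊ ≈ 0#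
    Σf₊≈0 = sumOver-∅ f₊ X₊-empty
  ... | false = trans (+-congˡ (sumOver-square (f ∘ Fin.suc) count≤1))
                      (trans (+-identityˡ _) (sym (*-cong (+-identityˡ _) (+-identityˡ _))))

module PolynomialFunctions {c ℓ : Level} (K : CommutativeRing c ℓ) (K-field : IsField K) where
  open CommutativeRing K
  open CommutativeSemiringExp commutativeSemiring using (_^_)
  open RingProperties ring using (x∙y⁻¹≈ε⇒x≈y)
  open FieldProperties K K-field using (x*y≈0⇒y≈0)
  open Exponentiation K using (geometric)
  open IntegerRingSolver K using (solve; _:=_; _:+_; _:*_; _:-_)
  open SetoidReasoning setoid

  data Poly≤ : ℕ → (Carrier → Carrier) → Set (c ⊔ ℓ) where
    const  : ∀ {f} a → (∀ x → f x ≈ a) → Poly≤ 0 f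
    horner : ∀ {d f} a g → Poly≤ d g → (∀ x → f x ≈ a + x * g x) → Poly≤ (suc d) f

  Poly≤-mono : ∀ {d f} → Poly≤ d f → Poly≤ (suc d) f
  Poly≤-mono (const a f≈a) = horner a (λ _ → 0#) (const 0# (λ _ → refl))
    (λ x → trans (f≈a x) (sym (trans (+-congˡ (zeroʳ x)) (+-identityʳ a))))
  Poly≤-mono (horner a g g≤ f≈) = horner a g (Poly≤-mono g≤) f≈

  Poly≤-+ : ∀ {d f g} → Poly≤ d f → Poly≤ d g → Poly≤ d (λ x → f x + g x)
  Poly≤-+ (const a f≈) (const b g≈) = const (a + b) (λ x → +-cong (f≈ x) (g≈ x))
  Poly≤-+ (horner a f′ f′≤ f≈) (horner b g′ g′≤ g≈) =
    horner (a + b) (λ x → f′ x + g′ x) (Poly≤-+ f′≤ g′≤) (λ x → trans (+-cong (f≈ x) (g≈ x))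
      (solve 5 (λ a b x u v → (a :+ x :* u) :+ (b :+ x :* v) := (a :+ b) :+ x :* (u :+ v)) refl a b x (f′ x) (g′ x)))

  Poly≤-*ˡ : ∀ {d f} k → Poly≤ d f → Poly≤ d (λ x → k * f x)
  Poly≤-*ˡ k (const a f≈) = const (k * a) (λ x → *-congˡ (f≈ x))
  Poly≤-*ˡ k (horner a g g≤ f≈) = horner (k * a) (λ x → k * g x) (Poly≤-*ˡ k g≤) (λ x → trans (*-congˡ (f≈ x))
    (solve 4 (λ k a x u → k :* (a :+ x :* u) := k :* a :+ x :* (k :* u)) refl k a x (g x)))

  Poly≤-+ˡ : ∀ {d f} k → Poly≤ d f → Poly≤ d (λ x → k + f x)
  Poly≤-+ˡ k (const a f≈) = const (k + a) (λ x → +-congˡ (f≈ x))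
  Poly≤-+ˡ k (horner a g g≤ f≈) = horner (k + a) g g≤ (λ x → trans (+-congˡ (f≈ x)) (sym (+-assoc k a _)))

  Poly≤-^* : ∀ {d f} n → Poly≤ d f → Poly≤ (n ℕ.+ d) (λ x → x ^ n * f x)
  Poly≤-^* zero f≤ = Poly≤-ext f≤ (λ x → sym (*-identityˡ _))
    where
    Poly≤-ext : ∀ {d f g} → Poly≤ d f → (∀ x → f x ≈ g x) → Poly≤ d g
    Poly≤-ext (const a f≈) f≈g = const a (λ x → trans (sym (f≈g x)) (f≈ x))
    Poly≤-ext (horner a h h≤ f≈) f≈g = horner a h h≤ (λ x → trans (sym (f≈g x)) (f≈ x))
  Poly≤-^* {f = f} (suc n) f≤ = horner 0# (λ x → x ^ n * f x) (Poly≤-^* n f≤)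
    (λ x → trans (*-assoc x (x ^ n) (f x)) (sym (+-identityˡ _)))

  Poly≤-geometric : ∀ k n → Poly≤ (n ℕ.* k) (λ x → geometric n (x ^ k))
  Poly≤-geometric k zero = const 1# (λ _ → refl)
  Poly≤-geometric k (suc n) = Poly≤-+ˡ 1# (Poly≤-^* k (Poly≤-geometric k n))

  factor-theorem : ∀ {d f} → Poly≤ (suc d) f → ∀ r →
                   ∃ λ g → Poly≤ d g × (∀ x → f x ≈ f r + (x - r) * g x)
  factor-theorem {zero} {f} (horner a g (const b g≈b) f≈) r = g , const b g≈b , λ x → begin
    f x                            ≈⟨ f≈ x ⟩
    a + x * g x                    ≈⟨ solve 4 (λ a x r u → a :+ x :* u := (a :+ r :* u) :+ (x :- r) :* u) refl a x r (g x) ⟩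
    (a + r * g x) + (x - r) * g x  ≈⟨ +-congʳ (+-congˡ (*-congˡ (trans (g≈b x) (sym (g≈b r))))) ⟩
    (a + r * g r) + (x - r) * g x  ≈⟨ +-congʳ (f≈ r) ⟨
    f r + (x - r) * g x            ∎
  factor-theorem {suc d} {f} (horner a g g≤ f≈) r with factor-theorem g≤ r
  ... | h , h≤ , g≈ = (λ x → g x + r * h x) , Poly≤-+ g≤ (Poly≤-mono (Poly≤-*ˡ r h≤)) , λ x → begin
    f x                                          ≈⟨ f≈ x ⟩
    a + x * g x                                  ≈⟨ +-congˡ (*-congˡ (g≈ x)) ⟩
    a + x * (g r + (x - r) * h x)
      ≈⟨ solve 5 (λ a x r u v → a :+ x :* (u :+ (x :- r) :* v) := (a :+ r :* u) :+ (x :- r) :* ((u :+ (x :- r) :* v) :+ r :* v))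
               refl a x r (g r) (h x) ⟩
    (a + r * g r) + (x - r) * ((g r + (x - r) * h x) + r * h x)
      ≈⟨ +-cong (sym (f≈ r)) (*-congˡ (+-congʳ (sym (g≈ x)))) ⟩
    f r + (x - r) * (g x + r * h x)              ∎

  Poly≤-roots : ∀ {n d f} (v : Fin n → Carrier) → (∀ {i j} → v i ≈ v j → i ≡ j) → Poly≤ d f →
                (X : Fin n → Bool) → (∀ i → X i ≡ true → f (v i) ≈ 0#) → d < count X → ∀ y → f y ≈ 0#
  Poly≤-roots v v-inj (const a f≈a) X roots 0<|X| y with count>0⇒∈ X 0<|X|
  ... | r , Xr = trans (f≈a y) (trans (sym (f≈a (v r))) (roots r Xr))
  Poly≤-roots {n} {suc d} {f} v v-inj f≤@(horner _ _ _ _) X roots d<|X| y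
    with count>0⇒∈ X (ℕ.<-trans z<s d<|X|)
  ... | r , Xr with factor-theorem f≤ (v r)
  ...   | g , g≤ , f≈ = begin
      f y                              ≈⟨ f≈ y ⟩
      f (v r) + (y - v r) * g y        ≈⟨ +-cong (roots r Xr) (*-congˡ (Poly≤-roots v v-inj g≤ X⁻ g-roots d<|X⁻| y)) ⟩
      0# + (y - v r) * 0#              ≈⟨ trans (+-identityˡ _) (zeroʳ _) ⟩
      0#                               ∎
    where
    X⁻ : Fin n → Bool
    X⁻ i = X i ∧ not (i == r)
    d<|X⁻| : d < count X⁻
    d<|X⁻| = ℕ.≤-pred (ℕ.<-≤-trans d<|X| (ℕ.≤-reflexive (count-remove {X = X} Xr)))
    g-roots : ∀ i → X⁻ i ≡ true → g (v i) ≈ 0#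
    g-roots i X⁻i = x*y≈0⇒y≈0 vi-vr≉0 (begin
      (v i - v r) * g (v i)            ≈⟨ +-identityˡ _ ⟨
      0# + (v i - v r) * g (v i)       ≈⟨ +-congʳ (roots r Xr) ⟨
      f (v r) + (v i - v r) * g (v i)  ≈⟨ f≈ (v i) ⟨
      f (v i)                          ≈⟨ roots i (∧-conicalˡ (X i) _ X⁻i) ⟩
      0#                               ∎)
      where
      vi-vr≉0 : ¬ v i - v r ≈ 0#
      vi-vr≉0 vi-vr≈0 = ==false⇒≢ (not-injective (∧-conicalʳ (X i) _ X⁻i)) (v-inj (x∙y⁻¹≈ε⇒x≈y _ _ vi-vr≈0))

module PrimeSubfield {c ℓ : Level} (K : CommutativeRing c ℓ)
  (q : ℕ) (p-prime : Prime (suc q)) (K-char : IsFieldOfCharacteristic (suc q) K) where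

  open CommutativeRing K
  open IsFieldOfCharacteristic K-char
  open MonoidMult +-monoid using (×-homo-+; ×-homo-1) renaming (_×_ to _·_)
  open SemiringMult semiring using (×1-homo-*)
  open CommutativeSemiringExp commutativeSemiring using (_^_)
  open RingProperties ring using (-‿involutive; +-inverseʳ-unique; +-cancelˡ; -1*x≈-x; x∙y⁻¹≈ε⇒x≈y; x≈y⇒x∙y⁻¹≈ε)
  open FieldProperties K isField
  open RingSums K using (sumOver; sumOver-permute; sumOver-congˡ)
  open IntegerRingSolver K using (solve; _:=_; _:+_; _:*_; _:-_; :-_; con)
  open SetoidReasoning setoid

  p : ℕ
  p = suc q

  F : Set
  F = Fin p

  multiple-of-p : ∀ a → (a ℕ.* p) · 1# ≈ 0#
  multiple-of-p a = trans (×1-homo-* a p) (trans (*-congˡ char) (zeroʳ _))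

  q·1≈-1 : q · 1# ≈ - 1#
  q·1≈-1 = +-inverseʳ-unique 1# (q · 1#) char

  ·1-invertible : ∀ {r} → 0 < r → r < p → ∃ λ b → (b · 1#) * (r · 1#) ≈ 1#
  ·1-invertible {suc r} _ r<p with coprime-Bézout (prime⇒coprime p-prime r<p)
  ... | Bézout.Identity.+- x y 1+yr≡xp = q ℕ.* y , (begin
    ((q ℕ.* y) · 1#) * (suc r · 1#)  ≈⟨ *-congʳ (×1-homo-* q y) ⟩
    (q · 1# * y · 1#) * (suc r · 1#) ≈⟨ *-assoc _ _ _ ⟩
    q · 1# * (y · 1# * suc r · 1#)   ≈⟨ *-cong q·1≈-1 (trans (sym (×1-homo-* y (suc r))) yr≈-1) ⟩
    - 1# * - 1#                       ≈⟨ trans (-1*x≈-x (- 1#)) (-‿involutive 1#) ⟩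
    1#                                ∎)
    where
    yr≈-1 : (y ℕ.* suc r) · 1# ≈ - 1#
    yr≈-1 = +-inverseʳ-unique 1# _ (begin
      1# + (y ℕ.* suc r) · 1#     ≈⟨ +-congʳ (×-homo-1 1#) ⟨
      1 · 1# + (y ℕ.* suc r) · 1# ≈⟨ ×-homo-+ 1# 1 (y ℕ.* suc r) ⟨
      (1 ℕ.+ y ℕ.* suc r) · 1#    ≡⟨ ≡.cong (_· 1#) 1+yr≡xp ⟩
      (x ℕ.* p) · 1#              ≈⟨ multiple-of-p x ⟩
      0#                          ∎)
  ... | Bézout.Identity.-+ x y 1+xp≡yr = y , (begin
    (y · 1#) * (suc r · 1#)     ≈⟨ ×1-homo-* y (suc r) ⟨
    (y ℕ.* suc r) · 1#          ≡⟨ ≡.cong (_· 1#) 1+xp≡yr ⟨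
    (1 ℕ.+ x ℕ.* p) · 1#        ≈⟨ ×-homo-+ 1# 1 (x ℕ.* p) ⟩
    1 · 1# + (x ℕ.* p) · 1#     ≈⟨ +-cong (×-homo-1 1#) (multiple-of-p x) ⟩
    1# + 0#                     ≈⟨ +-identityʳ 1# ⟩
    1#                          ∎)

  ·1≈0⇒≡0 : ∀ {n} → n < p → n · 1# ≈ 0# → n ≡ 0
  ·1≈0⇒≡0 {zero} _ _ = ≡.refl
  ·1≈0⇒≡0 {suc n} n<p n≈0 with ·1-invertible z<s n<p
  ... | b , bn≈1 = ⊥-elim (1≉0 (begin
    1#                   ≈⟨ bn≈1 ⟨
    b · 1# * suc n · 1#  ≈⟨ *-congˡ n≈0 ⟩
    b · 1# * 0#          ≈⟨ zeroʳ _ ⟩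
    0#                   ∎))

  ·1-mod : ∀ n → n · 1# ≈ (n % p) · 1#
  ·1-mod n = begin
    n · 1#                                  ≡⟨ ≡.cong (_· 1#) (m≡m%n+[m/n]*n n p) ⟩
    (n % p ℕ.+ (n / p) ℕ.* p) · 1#          ≈⟨ ×-homo-+ 1# (n % p) _ ⟩
    (n % p) · 1# + ((n / p) ℕ.* p) · 1#     ≈⟨ +-congˡ (multiple-of-p (n / p)) ⟩
    (n % p) · 1# + 0#                       ≈⟨ +-identityʳ _ ⟩
    (n % p) · 1#                            ∎

  e : F → Carrier
  e i = toℕ i · 1#

  fin : ℕ → F
  fin n = fromℕ< (m%n<n n p)

  e-fin : ∀ n → e (fin n) ≈ n · 1#
  e-fin n = trans (reflexive (≡.cong (_· 1#) (toℕ-fromℕ< (m%n<n n p)))) (sym (·1-mod n))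

  ·1-injective-≤ : ∀ {a b} → a ≤ b → b < p → a · 1# ≈ b · 1# → a ≡ b
  ·1-injective-≤ {a} {b} a≤b b<p a≈b = ℕ.≤-antisym a≤b (ℕ.m∸n≡0⇒m≤n (·1≈0⇒≡0 (ℕ.≤-<-trans (ℕ.m∸n≤m b a) b<p)
    (+-cancelˡ (a · 1#) _ _ (begin
      a · 1# + (b ℕ.∸ a) · 1#  ≈⟨ ×-homo-+ 1# a (b ℕ.∸ a) ⟨
      (a ℕ.+ (b ℕ.∸ a)) · 1#   ≡⟨ ≡.cong (_· 1#) (ℕ.m+[n∸m]≡n a≤b) ⟩
      b · 1#                   ≈⟨ a≈b ⟨
      a · 1#                   ≈⟨ +-identityʳ _ ⟨
      a · 1# + 0#              ∎))))

  e-injective : ∀ {i j} → e i ≈ e j → i ≡ j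
  e-injective {i} {j} i≈j with ℕ.≤-total (toℕ i) (toℕ j)
  ... | inj₁ i≤j = toℕ-injective (·1-injective-≤ i≤j (toℕ<n j) i≈j)
  ... | inj₂ j≤i = toℕ-injective (≡.sym (·1-injective-≤ j≤i (toℕ<n i) (sym i≈j)))

  e≉0 : ∀ {i} → i ≢ Fin.zero → ¬ e i ≈ 0#
  e≉0 i≢0 i≈0 = i≢0 (e-injective i≈0)

  infixl 6 _⊕_ _⊖_
  infixl 7 _⊗_

  _⊕_ _⊗_ _⊖_ : F → F → F
  i ⊕ j = fin (toℕ i ℕ.+ toℕ j)
  i ⊗ j = fin (toℕ i ℕ.* toℕ j)
  i ⊖ j = fin (toℕ i ℕ.+ q ℕ.* toℕ j)

  one : F
  one = fin 1

  e-⊕ : ∀ i j → e (i ⊕ j) ≈ e i + e j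
  e-⊕ i j = trans (e-fin (toℕ i ℕ.+ toℕ j)) (×-homo-+ 1# (toℕ i) (toℕ j))

  e-⊗ : ∀ i j → e (i ⊗ j) ≈ e i * e j
  e-⊗ i j = trans (e-fin (toℕ i ℕ.* toℕ j)) (×1-homo-* (toℕ i) (toℕ j))

  e-⊖ : ∀ i j → e (i ⊖ j) ≈ e i - e j
  e-⊖ i j = begin
    e (i ⊖ j)                    ≈⟨ trans (e-fin (toℕ i ℕ.+ q ℕ.* toℕ j)) (×-homo-+ 1# (toℕ i) _) ⟩
    e i + (q ℕ.* toℕ j) · 1#     ≈⟨ +-congˡ (×1-homo-* q (toℕ j)) ⟩
    e i + q · 1# * e j           ≈⟨ +-congˡ (trans (*-congʳ q·1≈-1) (-1*x≈-x (e j))) ⟩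
    e i - e j                    ∎

  e-one : e one ≈ 1#
  e-one = trans (e-fin 1) (×-homo-1 1#)

  ⊗-inverse : ∀ {i} → i ≢ Fin.zero → ∃ λ u → e u * e i ≈ 1#
  ⊗-inverse {Fin.zero} 0≢0 = ⊥-elim (0≢0 ≡.refl)
  ⊗-inverse {i@(Fin.suc _)} _ with ·1-invertible z<s (toℕ<n i)
  ... | b , bi≈1 = fin b , trans (*-congʳ (e-fin b)) bi≈1

  ⊖-⊕-cancel : ∀ i a → i ⊖ a ⊕ a ≡ i
  ⊖-⊕-cancel i a = e-injective (begin
    e (i ⊖ a ⊕ a)    ≈⟨ trans (e-⊕ (i ⊖ a) a) (+-congʳ (e-⊖ i a)) ⟩
    e i - e a + e a  ≈⟨ solve 2 (λ x y → x :- y :+ y := x) refl (e i) (e a) ⟩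
    e i              ∎)

  ⊕-⊖-cancel : ∀ i a → i ⊕ a ⊖ a ≡ i
  ⊕-⊖-cancel i a = e-injective (begin
    e (i ⊕ a ⊖ a)    ≈⟨ trans (e-⊖ (i ⊕ a) a) (+-congʳ (e-⊕ i a)) ⟩
    e i + e a - e a  ≈⟨ solve 2 (λ x y → x :+ y :- y := x) refl (e i) (e a) ⟩
    e i              ∎)

  translation : F → Permutation p p
  translation a = permutation (_⊕ a) (_⊖ a) (λ i → ⊖-⊕-cancel i a) (λ i → ⊕-⊖-cancel i a)

  ⊗-comm : ∀ i j → i ⊗ j ≡ j ⊗ i
  ⊗-comm i j = e-injective (trans (e-⊗ i j) (trans (*-comm (e i) (e j)) (sym (e-⊗ j i))))

  ⊗-assoc : ∀ i j k → (i ⊗ j) ⊗ k ≡ i ⊗ (j ⊗ k)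
  ⊗-assoc i j k = e-injective (begin
    e ((i ⊗ j) ⊗ k)    ≈⟨ trans (e-⊗ (i ⊗ j) k) (*-congʳ (e-⊗ i j)) ⟩
    (e i * e j) * e k  ≈⟨ *-assoc (e i) (e j) (e k) ⟩
    e i * (e j * e k)  ≈⟨ trans (e-⊗ i (j ⊗ k)) (*-congˡ (e-⊗ j k)) ⟨
    e (i ⊗ (j ⊗ k))    ∎)

  ⊗-zeroʳ : ∀ i → i ⊗ Fin.zero ≡ Fin.zero
  ⊗-zeroʳ i = e-injective (trans (e-⊗ i Fin.zero) (zeroʳ (e i)))

  ⊗-distribˡ-⊖ : ∀ s i j → s ⊗ (i ⊖ j) ≡ s ⊗ i ⊖ s ⊗ j
  ⊗-distribˡ-⊖ s i j = e-injective (begin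
    e (s ⊗ (i ⊖ j))          ≈⟨ trans (e-⊗ s (i ⊖ j)) (*-congˡ (e-⊖ i j)) ⟩
    e s * (e i - e j)        ≈⟨ solve 3 (λ s i j → s :* (i :- j) := s :* i :- s :* j) refl (e s) (e i) (e j) ⟩
    e s * e i - e s * e j    ≈⟨ trans (e-⊖ (s ⊗ i) (s ⊗ j)) (+-cong (e-⊗ s i) (-‿cong (e-⊗ s j))) ⟨
    e (s ⊗ i ⊖ s ⊗ j)        ∎)

  inverse-⊗-cancel : ∀ {u x} → e u * e x ≈ 1# → ∀ i → u ⊗ (x ⊗ i) ≡ i
  inverse-⊗-cancel {u} {x} ux≈1 i = e-injective (begin
    e (u ⊗ (x ⊗ i))      ≈⟨ trans (e-⊗ u (x ⊗ i)) (*-congˡ (e-⊗ x i)) ⟩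
    e u * (e x * e i)    ≈⟨ *-assoc _ _ _ ⟨
    (e u * e x) * e i    ≈⟨ *-congʳ ux≈1 ⟩
    1# * e i             ≈⟨ *-identityˡ _ ⟩
    e i                  ∎)

  dilation : ∀ t → t ≢ Fin.zero → Permutation p p
  dilation t t≢0 = permutation (t ⊗_) (u ⊗_)
    (inverse-⊗-cancel {t} {u} (trans (*-comm (e t) (e u)) ut≈1)) (inverse-⊗-cancel {u} {t} ut≈1)
    where
    u : F
    u = proj₁ (⊗-inverse t≢0)
    ut≈1 : e u * e t ≈ 1#
    ut≈1 = proj₂ (⊗-inverse t≢0)

  ·1≉0 : ∀ {n} → 0 < n → n < p → ¬ n · 1# ≈ 0#
  ·1≉0 0<n n<p n≈0 = ℕ.<⇒≢ 0<n (≡.sym (·1≈0⇒≡0 n<p n≈0))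

  minus-one : F
  minus-one = fin q

  e-minus-one : e minus-one ≈ - 1#
  e-minus-one = trans (e-fin q) q·1≈-1

  infixr 8 _⊗^_

  _⊗^_ : F → ℕ → F
  i ⊗^ zero = one
  i ⊗^ suc k = i ⊗ i ⊗^ k

  e-⊗^ : ∀ i k → e (i ⊗^ k) ≈ e i ^ k
  e-⊗^ i zero = e-one
  e-⊗^ i (suc k) = trans (e-⊗ i (i ⊗^ k)) (*-congˡ (e-⊗^ i k))

  squares-to-one : ∀ i → e i * e i ≈ 1# → i ≡ one ⊎ i ≡ minus-one
  squares-to-one i i²≈1 with i Fin.≟ one
  ... | yes i≡1 = inj₁ i≡1
  ... | no i≢1 = inj₂ (e-injective (trans (x∙y⁻¹≈ε⇒x≈y _ _ (x*y≈0⇒y≈0 i-1≉0 (begin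
      (e i - 1#) * (e i - - 1#)  ≈⟨ solve 1 (λ x → (x :- con 1ℤ) :* (x :- :- con 1ℤ) := x :* x :- con 1ℤ) refl (e i) ⟩
      e i * e i - 1#             ≈⟨ x≈y⇒x∙y⁻¹≈ε i²≈1 ⟩
      0#                         ∎))) (sym e-minus-one)))
    where
    i-1≉0 : ¬ e i - 1# ≈ 0#
    i-1≉0 i-1≈0 = i≢1 (e-injective (trans (x∙y⁻¹≈ε⇒x≈y _ _ i-1≈0) (sym e-one)))

  sumOver-shift : ∀ A f → sumOver (λ i → A (i ⊖ one)) f ≈ sumOver A (λ i → f (i ⊕ one))
  sumOver-shift A f = trans (sumOver-permute (λ i → A (i ⊖ one)) f (translation one))
    (sumOver-congˡ (λ i → A (i ⊕ one ⊖ one)) A (λ i → f (i ⊕ one)) (λ i → ≡.cong A (⊕-⊖-cancel i one)))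

  count-shift : ∀ A → count (λ i → A (i ⊖ one)) ≡ count A
  count-shift A = ≡.trans (count-permute (λ i → A (i ⊖ one)) (translation one))
                          (count-cong (λ i → ≡.cong A (⊕-⊖-cancel i one)))

  fermat : ∀ {a} → a ≢ Fin.zero → e a ^ q ≈ 1#
  fermat {a} a≢0 = sym (*-cancelˡ (product-≉0 (e ∘ Fin.suc) (λ j → e≉0 {Fin.suc j} (λ ()))) (begin
    P * 1#                                  ≈⟨ *-comm P 1# ⟩
    g Fin.zero * P                          ≈⟨ Π.sum-permute g (dilation a a≢0) ⟩
    g (a ⊗ Fin.zero) * Π.sum (g ∘ (a ⊗_) ∘ Fin.suc)
      ≈⟨ *-cong (reflexive (≡.cong g (⊗-zeroʳ a))) (Π.sum-cong-≋ g[a⊗suc]) ⟩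
    1# * Π.sum (λ j → e a * e (Fin.suc j))  ≈⟨ *-identityˡ _ ⟩
    Π.sum (λ j → e a * e (Fin.suc j))       ≈⟨ Π.∑-distrib-+ (λ _ → e a) (e ∘ Fin.suc) ⟩
    Π.sum {q} (λ _ → e a) * P               ≈⟨ *-congʳ (Π.sum-replicate q {e a}) ⟩
    e a ^ q * P                             ≈⟨ *-comm _ P ⟩
    P * e a ^ q                             ∎))
    where
    P : Carrier
    P = Π.sum (e ∘ Fin.suc)
    -- g is e with the value at 0 replaced by 1, so Π g = P; multiplication by a permutes F and fixes 0.
    g : F → Carrier
    g Fin.zero = 1#
    g (Fin.suc j) = e (Fin.suc j)
    g[a⊗suc] : ∀ j → g (a ⊗ Fin.suc j) ≈ e a * e (Fin.suc j)
    g[a⊗suc] j with a ⊗ Fin.suc j in a⊗j≡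
    ... | Fin.zero = ⊥-elim (*-≉0 (e≉0 a≢0) (e≉0 {Fin.suc j} (λ ()))
                       (trans (sym (e-⊗ a (Fin.suc j))) (reflexive (≡.cong e a⊗j≡))))
    ... | Fin.suc k = trans (reflexive (≡.cong e (≡.sym a⊗j≡))) (e-⊗ a (Fin.suc j))

module VanishingSumsOfRootsOfUnity {c ℓ : Level} (K : CommutativeRing c ℓ)
  (q : ℕ) (p-prime : Prime (suc q)) (K-char : IsFieldOfCharacteristic (suc q) K)
  (m₀ d : ℕ) (3≤m₀ : 3 ≤ m₀) (d₀m₀≡q : suc d ℕ.* m₀ ≡ q) where

  open CommutativeRing K
  open IsFieldOfCharacteristic K-char using (isField; 1≉0)
  open MonoidMult +-monoid using () renaming (_×_ to _·_)
  open PrimeSubfield K q p-prime K-char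
  open FieldProperties K isField using (x*y≈0⇒y≈0; *-≉0)
  open RingSums K
  open Exponentiation K using (1#^≈1#; 0#^≈0#; geometric; geometric-identity)
  open PolynomialFunctions K isField using (Poly≤-geometric; Poly≤-roots)
  open CommutativeSemiringExp commutativeSemiring using (_^_; ^-congˡ; ^-assocʳ; ^-distrib-*)
  open RingProperties ring using (x∙y⁻¹≈ε⇒x≈y; x≈y⇒x∙y⁻¹≈ε; -‿injective; -0#≈0#)
  open CommutativeMonoidSum +-commutativeMonoid using (sum)
  open IntegerRingSolver K using (solve; _:=_; _:+_; _:*_; _:-_; con)
  open SetoidReasoning setoid

  -- The group μ of m₀-th roots of unity in 𝔽_p

  0#^m₀≈0# : 0# ^ m₀ ≈ 0#
  0#^m₀≈0# = 0#^≈0# (ℕ.<-≤-trans z<s 3≤m₀)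

  μ : F → Bool
  μ i = i ⊗^ m₀ == one

  μ-sound : ∀ {i} → μ i ≡ true → e i ^ m₀ ≈ 1#
  μ-sound {i} μi = trans (sym (e-⊗^ i m₀)) (trans (reflexive (≡.cong e (==⇒≡ {i = i ⊗^ m₀} {j = one} μi))) e-one)

  μ-complete : ∀ {i} → e i ^ m₀ ≈ 1# → μ i ≡ true
  μ-complete {i} i^m₀≈1 = dec-true (i ⊗^ m₀ Fin.≟ one) (e-injective (trans (e-⊗^ i m₀) (trans i^m₀≈1 (sym e-one))))

  μ-≢0 : ∀ {i} → μ i ≡ true → i ≢ Fin.zero
  μ-≢0 μi ≡.refl = 1≉0 (trans (sym (μ-sound μi)) 0#^m₀≈0#)

  μ-one : μ one ≡ true
  μ-one = μ-complete (trans (^-congˡ m₀ e-one) (1#^≈1# m₀))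

  μ-⊗ : ∀ {a b} → μ a ≡ true → μ b ≡ true → μ (a ⊗ b) ≡ true
  μ-⊗ {a} {b} μa μb = μ-complete (begin
    e (a ⊗ b) ^ m₀          ≈⟨ ^-congˡ m₀ (e-⊗ a b) ⟩
    (e a * e b) ^ m₀        ≈⟨ ^-distrib-* (e a) (e b) m₀ ⟩
    e a ^ m₀ * e b ^ m₀     ≈⟨ *-cong (μ-sound μa) (μ-sound μb) ⟩
    1# * 1#                 ≈⟨ *-identityˡ 1# ⟩
    1#                      ∎)

  μ-inverse : ∀ {s} → μ s ≡ true → ∃ λ u → μ u ≡ true × (∀ i → u ⊗ (s ⊗ i) ≡ i)
  μ-inverse {s} μs = u , μ-complete u^m₀≈1 , inverse-⊗-cancel {u} {s} us≈1
    where
    u : F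
    u = proj₁ (⊗-inverse (μ-≢0 {s} μs))
    us≈1 : e u * e s ≈ 1#
    us≈1 = proj₂ (⊗-inverse (μ-≢0 {s} μs))
    u^m₀≈1 : e u ^ m₀ ≈ 1#
    u^m₀≈1 = begin
      e u ^ m₀                ≈⟨ *-identityʳ _ ⟨
      e u ^ m₀ * 1#           ≈⟨ *-congˡ (μ-sound μs) ⟨
      e u ^ m₀ * e s ^ m₀     ≈⟨ ^-distrib-* (e u) (e s) m₀ ⟨
      (e u * e s) ^ m₀        ≈⟨ ^-congˡ m₀ us≈1 ⟩
      1# ^ m₀                 ≈⟨ 1#^≈1# m₀ ⟩
      1#                      ∎

  NZ : F → Bool
  NZ i = not (i == Fin.zero)

  NZ⇒≢0 : ∀ {i} → NZ i ≡ true → i ≢ Fin.zero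
  NZ⇒≢0 NZi = ==false⇒≢ (not-injective NZi)

  non-μ-is-root : ∀ {i} → i ≢ Fin.zero → μ i ≡ false → geometric d (e i ^ m₀) ≈ 0#
  non-μ-is-root {i} i≢0 ¬μi = x*y≈0⇒y≈0 y-1≉0 (begin
    (y - 1#) * geometric d y   ≈⟨ geometric-identity d y ⟩
    y ^ suc d - 1#             ≈⟨ +-congʳ (^-assocʳ (e i) m₀ (suc d)) ⟩
    e i ^ (m₀ ℕ.* suc d) - 1#  ≡⟨ ≡.cong (λ k → e i ^ k - 1#) (≡.trans (ℕ.*-comm m₀ (suc d)) d₀m₀≡q) ⟩
    e i ^ q - 1#               ≈⟨ x≈y⇒x∙y⁻¹≈ε (fermat i≢0) ⟩
    0#                         ∎)
    where
    y : Carrier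
    y = e i ^ m₀
    y-1≉0 : ¬ y - 1# ≈ 0#
    y-1≉0 y-1≈0 with () ← ≡.trans (≡.sym ¬μi) (μ-complete (x∙y⁻¹≈ε⇒x≈y _ _ y-1≈0))

  count-NZ : count NZ ≡ q
  count-NZ = count-≢ Fin.zero

  count-non-μ : count (λ i → NZ i ∧ not (μ i)) ≤ d ℕ.* m₀
  count-non-μ = ℕ.≮⇒≥ λ d*m₀<count → 1≉0 (begin
    1#                           ≈⟨ geometric-at-0 d ⟨
    geometric d (0# ^ m₀)        ≈⟨ Poly≤-roots e e-injective (Poly≤-geometric m₀ d) _ roots d*m₀<count 0# ⟩
    0#                           ∎)
    where
    roots : ∀ i → (NZ i ∧ not (μ i)) ≡ true → geometric d (e i ^ m₀) ≈ 0#
    roots i NZi∧¬μi = non-μ-is-root (NZ⇒≢0 (∧-conicalˡ (NZ i) _ NZi∧¬μi)) (not-injective (∧-conicalʳ (NZ i) _ NZi∧¬μi))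
    geometric-at-0 : ∀ n → geometric n (0# ^ m₀) ≈ 1#
    geometric-at-0 zero = refl
    geometric-at-0 (suc n) = trans (+-congˡ (trans (*-congʳ 0#^m₀≈0#) (zeroˡ _))) (+-identityʳ 1#)

  m₀≤|μ| : m₀ ≤ count μ
  m₀≤|μ| = ℕ.+-cancelʳ-≤ (d ℕ.* m₀) m₀ (count μ) (ℕ.≤-trans
    (ℕ.≤-reflexive (≡.trans (≡.trans d₀m₀≡q (≡.sym count-NZ)) (count-split NZ μ)))
    (ℕ.+-mono-≤ (count-mono {Y = μ} (λ i → ∧-conicalʳ (NZ i) _)) count-non-μ))

  μ-non-involution : F → Bool
  μ-non-involution i = μ i ∧ not (i ⊗ i == one)

  μ-element-of-order>2 : ∃ λ t → μ t ≡ true × ¬ e t * e t ≈ 1#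
  μ-element-of-order>2 with count μ-non-involution ℕ.≟ 0
  ... | no |T|≢0 with count>0⇒∈ μ-non-involution (ℕ.n≢0⇒n>0 |T|≢0)
  ...   | t , Tt = t , ∧-conicalˡ (μ t) _ Tt , λ t²≈1 → ==false⇒≢ {i = t ⊗ t} {j = one}
            (not-injective (∧-conicalʳ (μ t) _ Tt)) (e-injective (trans (e-⊗ t t) (trans t²≈1 (sym e-one))))
  μ-element-of-order>2 | yes |T|≡0 =
    ⊥-elim (ℕ.<-irrefl ≡.refl (ℕ.≤-trans 3≤m₀ (ℕ.≤-trans m₀≤|μ| (count-⊆-pair one minus-one μ⊆±1))))
    where
    μ⊆±1 : ∀ i → μ i ≡ true → i ≡ one ⊎ i ≡ minus-one
    μ⊆±1 i μi = squares-to-one i (trans (sym (e-⊗ i i)) (trans (reflexive (≡.cong e (==⇒≡ {i = i ⊗ i} {j = one} i²==1))) e-one))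
      where
      i²==1 : (i ⊗ i == one) ≡ true
      i²==1 = not-injective (≡.subst (λ b → (b ∧ not (i ⊗ i == one)) ≡ false) μi (count≡0⇒∉ {X = μ-non-involution} |T|≡0 i))

  t : F
  t = proj₁ μ-element-of-order>2

  μ-t : μ t ≡ true
  μ-t = proj₁ (proj₂ μ-element-of-order>2)

  t²≉1 : ¬ e t * e t ≈ 1#
  t²≉1 = proj₂ (proj₂ μ-element-of-order>2)

  t≉1 : ¬ e t ≈ 1#
  t≉1 t≈1 = t²≉1 (trans (*-cong t≈1 t≈1) (*-identityˡ 1#))

  -- μ-stable subsets of 𝔽_p

  Invariant : (F → Bool) → Set
  Invariant X = ∀ s i → μ s ≡ true → X i ≡ true → X (s ⊗ i) ≡ true

  invariant-≡ : ∀ X → Invariant X → ∀ s i → μ s ≡ true → X (s ⊗ i) ≡ X i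
  invariant-≡ X X-inv s i μs with X i in Xi | μ-inverse {s} μs
  ... | true  | _ = X-inv s i μs Xi
  ... | false | u , μu , u⊗s⊗i≡i with X (s ⊗ i) in Xsi
  ...   | false = ≡.refl
  ...   | true with () ← ≡.trans (≡.sym Xi) (≡.subst (λ j → X j ≡ true) (u⊗s⊗i≡i i) (X-inv u (s ⊗ i) μu Xsi))

  invariant-∖ : ∀ X Y → Invariant X → Invariant Y → Invariant (λ i → X i ∧ not (Y i))
  invariant-∖ X Y X-inv Y-inv s i μs X∖Yi =
    ≡.cong₂ _∧_ (X-inv s i μs (∧-conicalˡ (X i) _ X∖Yi))
                (≡.trans (≡.cong not (invariant-≡ Y Y-inv s i μs)) (∧-conicalʳ (X i) _ X∖Yi))

  zero-invariant : Invariant (_== Fin.zero)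
  zero-invariant s i _ i==0 rewrite ==⇒≡ {i = i} {j = Fin.zero} i==0 | ⊗-zeroʳ s = ==-refl {suc q} Fin.zero

  coset-invariant : ∀ u → Invariant (λ i → μ (u ⊗ i))
  coset-invariant u s i μs μui = ≡.subst (λ j → μ j ≡ true) s[ui]≡u[si] (μ-⊗ {s} {u ⊗ i} μs μui)
    where
    s[ui]≡u[si] : s ⊗ (u ⊗ i) ≡ u ⊗ (s ⊗ i)
    s[ui]≡u[si] = ≡.trans (≡.sym (⊗-assoc s u i)) (≡.trans (≡.cong (_⊗ i) (⊗-comm s u)) (⊗-assoc u s i))

  invariant-sum-vanishes : ∀ X → Invariant X → ∀ f c → (∀ i → f (t ⊗ i) ≈ c * f i) → ¬ c ≈ 1# →
                           sumOver X f ≈ 0#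
  invariant-sum-vanishes X X-inv f c f-hom c≉1 = x*y≈0⇒y≈0 (λ c-1≈0 → c≉1 (x∙y⁻¹≈ε⇒x≈y _ _ c-1≈0)) (begin
    (c - 1#) * Σ          ≈⟨ solve 2 (λ c s → (c :- con 1ℤ) :* s := c :* s :- s) refl c Σ ⟩
    c * Σ - Σ             ≈⟨ x≈y⇒x∙y⁻¹≈ε (sym Σ≈cΣ) ⟩
    0#                    ∎)
    where
    Σ : Carrier
    Σ = sumOver X f
    Σ≈cΣ : Σ ≈ c * Σ
    Σ≈cΣ = begin
      Σ                                        ≈⟨ sumOver-permute X f (dilation t (μ-≢0 {t} μ-t)) ⟩
      sumOver (λ i → X (t ⊗ i)) (λ i → f (t ⊗ i))
        ≈⟨ sumOver-cong _ X _ _ (λ i → invariant-≡ X X-inv t i μ-t) (λ i _ → f-hom i) ⟩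
      sumOver X (λ i → c * f i)                ≈⟨ sumOver-*ˡ X c f ⟩
      c * Σ                                    ∎

  Σe-vanishes : ∀ X → Invariant X → sumOver X e ≈ 0#
  Σe-vanishes X X-inv = invariant-sum-vanishes X X-inv e (e t) (e-⊗ t) t≉1

  Σe²-vanishes : ∀ X → Invariant X → sumOver X (λ i → e i * e i) ≈ 0#
  Σe²-vanishes X X-inv = invariant-sum-vanishes X X-inv (λ i → e i * e i) (e t * e t) square-hom t²≉1
    where
    square-hom : ∀ i → e (t ⊗ i) * e (t ⊗ i) ≈ (e t * e t) * (e i * e i)
    square-hom i = trans (*-cong (e-⊗ t i) (e-⊗ t i))
      (solve 2 (λ x y → (x :* y) :* (x :* y) := (x :* x) :* (y :* y)) refl (e t) (e i))

  0<|μ| : 0 < count μ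
  0<|μ| = ℕ.<-≤-trans z<s (ℕ.≤-trans 3≤m₀ m₀≤|μ|)

  |μ|∣count : ∀ Y → Invariant Y → Y Fin.zero ≡ false → count μ ∣ count Y
  |μ|∣count Y = go (count Y) Y ℕ.≤-refl
    where
    go : ∀ b Y → count Y ≤ b → Invariant Y → Y Fin.zero ≡ false → count μ ∣ count Y
    go b Y _ _ _ with count Y ℕ.≟ 0
    go b Y _ _ _ | yes |Y|≡0 = ≡.subst (count μ ∣_) (≡.sym |Y|≡0) (count μ ∣0)
    go zero Y |Y|≤0 _ _ | no |Y|≢0 = ⊥-elim (|Y|≢0 (ℕ.n≤0⇒n≡0 |Y|≤0))
    go (suc b) Y |Y|≤1+b Y-inv Y0≡false | no |Y|≢0 =
      ≡.subst (count μ ∣_) (≡.sym |Y|≡|μ|+|Y⁻|) (∣m∣n⇒∣m+n ∣-refl (go b Y⁻ |Y⁻|≤b Y⁻-inv Y⁻0≡false))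
      where
      x : F
      x = proj₁ (count>0⇒∈ Y (ℕ.n≢0⇒n>0 |Y|≢0))
      Yx : Y x ≡ true
      Yx = proj₂ (count>0⇒∈ Y (ℕ.n≢0⇒n>0 |Y|≢0))
      x≢0 : x ≢ Fin.zero
      x≢0 x≡0 with () ← ≡.trans (≡.sym Y0≡false) (≡.subst (λ j → Y j ≡ true) x≡0 Yx)
      u : F
      u = proj₁ (⊗-inverse x≢0)
      ux≈1 : e u * e x ≈ 1#
      ux≈1 = proj₂ (⊗-inverse x≢0)
      C : F → Bool
      C i = μ (u ⊗ i)
      C⊆Y : ∀ i → C i ≡ true → Y i ≡ true
      C⊆Y i Ci = ≡.subst (λ j → Y j ≡ true)
                   (≡.trans (⊗-comm (u ⊗ i) x) (inverse-⊗-cancel {x} {u} (trans (*-comm _ _) ux≈1) i))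
                   (Y-inv (u ⊗ i) x Ci Yx)
      |C|≡|μ| : count C ≡ count μ
      |C|≡|μ| = ≡.trans (count-permute C (dilation x x≢0)) (count-cong (λ i → ≡.cong μ (inverse-⊗-cancel {u} {x} ux≈1 i)))
      Y⁻ : F → Bool
      Y⁻ i = Y i ∧ not (C i)
      |Y|≡|μ|+|Y⁻| : count Y ≡ count μ ℕ.+ count Y⁻
      |Y|≡|μ|+|Y⁻| = ≡.trans (count-⊆-split {X = Y} {Y = C} C⊆Y) (≡.cong (ℕ._+ count Y⁻) |C|≡|μ|)
      |Y⁻|≤b : count Y⁻ ≤ b
      |Y⁻|≤b = ℕ.≤-pred (ℕ.≤-trans (ℕ.+-monoˡ-≤ (count Y⁻) 0<|μ|)
                                   (ℕ.≤-trans (ℕ.≤-reflexive (≡.sym |Y|≡|μ|+|Y⁻|)) |Y|≤1+b))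
      Y⁻-inv : Invariant Y⁻
      Y⁻-inv = invariant-∖ Y C Y-inv (coset-invariant u)
      Y⁻0≡false : Y⁻ Fin.zero ≡ false
      Y⁻0≡false = ≡.cong (_∧ not (C Fin.zero)) Y0≡false

  shifted-Σe : ∀ A → Invariant A → sumOver (λ i → A (i ⊖ one)) e ≈ count A · 1#
  shifted-Σe A A-inv = begin
    sumOver (λ i → A (i ⊖ one)) e                  ≈⟨ sumOver-shift A e ⟩
    sumOver A (λ i → e (i ⊕ one))                   ≈⟨ sumOver-congʳ A _ _ (λ i _ → trans (e-⊕ i one) (+-congˡ e-one)) ⟩
    sumOver A (λ i → e i + 1#)                      ≈⟨ sumOver-∙ A e (λ _ → 1#) ⟩
    sumOver A e + sumOver A (λ _ → 1#)              ≈⟨ +-cong (Σe-vanishes A A-inv) (sym (count-·1 A)) ⟩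
    0# + count A · 1#                               ≈⟨ +-identityˡ _ ⟩
    count A · 1#                                    ∎

  shifted-Σe² : ∀ A → Invariant A → sumOver (λ i → A (i ⊖ one)) (λ i → e i * e i) ≈ count A · 1#
  shifted-Σe² A A-inv = begin
    sumOver (λ i → A (i ⊖ one)) (λ i → e i * e i)           ≈⟨ sumOver-shift A (λ i → e i * e i) ⟩
    sumOver A (λ i → e (i ⊕ one) * e (i ⊕ one))               ≈⟨ sumOver-congʳ A _ _ (λ i _ → square-shift i) ⟩
    sumOver A (λ i → e i * e i + (e i + (e i + 1#)))
      ≈⟨ trans (sumOver-∙ A (λ i → e i * e i) (λ i → e i + (e i + 1#)))
               (+-congˡ (trans (sumOver-∙ A e (λ i → e i + 1#)) (+-congˡ (sumOver-∙ A e (λ _ → 1#))))) ⟩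
    Σe² + (Σe + (Σe + sumOver A (λ _ → 1#)))
      ≈⟨ +-cong (Σe²-vanishes A A-inv) (+-cong Σe≈0 (+-cong Σe≈0 (sym (count-·1 A)))) ⟩
    0# + (0# + (0# + count A · 1#))                           ≈⟨ trans (+-identityˡ _) (trans (+-identityˡ _) (+-identityˡ _)) ⟩
    count A · 1#                                              ∎
    where
    Σe Σe² : Carrier
    Σe = sumOver A e
    Σe² = sumOver A (λ i → e i * e i)
    Σe≈0 : Σe ≈ 0#
    Σe≈0 = Σe-vanishes A A-inv
    square-shift : ∀ i → e (i ⊕ one) * e (i ⊕ one) ≈ e i * e i + (e i + (e i + 1#))
    square-shift i = trans (*-cong (trans (e-⊕ i one) (+-congˡ e-one)) (trans (e-⊕ i one) (+-congˡ e-one)))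
      (solve 1 (λ x → (x :+ con 1ℤ) :* (x :+ con 1ℤ) := x :* x :+ (x :+ (x :+ con 1ℤ))) refl (e i))

  growth : ∀ A B → Invariant A → Invariant B → (∀ i → A (i ⊖ one) ≡ true → B i ≡ true) →
           0 < count A → count B ≤ q → count A ℕ.+ 2 ≤ count B
  growth A B A-inv B-inv A⁺⊆B 0<|A| |B|≤q = by-size (count D) ≡.refl
    where
    A⁺ D : F → Bool
    A⁺ i = A (i ⊖ one)
    D i = B i ∧ not (A⁺ i)

    |B|≡|A|+|D| : count B ≡ count A ℕ.+ count D
    |B|≡|A|+|D| = ≡.trans (count-⊆-split {X = B} {Y = A⁺} A⁺⊆B) (≡.cong (ℕ._+ count D) (count-shift A))

    N : Carrier
    N = count A · 1#

    N+Σ≈0 : ∀ f → sumOver A⁺ f ≈ N → sumOver B f ≈ 0# → N + sumOver D f ≈ 0#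
    N+Σ≈0 f ΣA⁺≈N ΣB≈0 = trans (+-congʳ (sym ΣA⁺≈N)) (trans (sym (sumOver-⊆-split f A⁺⊆B)) ΣB≈0)

    N+ΣDe≈0 : N + sumOver D e ≈ 0#
    N+ΣDe≈0 = N+Σ≈0 e (shifted-Σe A A-inv) (Σe-vanishes B B-inv)

    N+ΣDe²≈0 : N + sumOver D (λ i → e i * e i) ≈ 0#
    N+ΣDe²≈0 = N+Σ≈0 (λ i → e i * e i) (shifted-Σe² A A-inv) (Σe²-vanishes B B-inv)

    |A|+|D|≤q : count A ℕ.+ count D ≤ q
    |A|+|D|≤q = ℕ.≤-trans (ℕ.≤-reflexive (≡.sym |B|≡|A|+|D|)) |B|≤q

    N≉0 : ¬ N ≈ 0#
    N≉0 = ·1≉0 0<|A| (ℕ.s≤s (ℕ.≤-trans (ℕ.m≤m+n (count A) (count D)) |A|+|D|≤q))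

    by-size : ∀ k → count D ≡ k → count A ℕ.+ 2 ≤ count B
    by-size zero |D|≡0 = ⊥-elim (N≉0 (begin
      N                  ≈⟨ +-identityʳ N ⟨
      N + 0#             ≈⟨ +-congˡ (sumOver-∅ e (count≡0⇒∉ {X = D} |D|≡0)) ⟨
      N + sumOver D e    ≈⟨ N+ΣDe≈0 ⟩
      0#                 ∎))
    by-size 1 |D|≡1 = ⊥-elim (*-≉0 N≉0 1+N≉0 (begin
      N * (1# + N)                 ≈⟨ solve 2 (λ n s → n :* (con 1ℤ :+ n) := (n :+ s :* s) :- (s :- n) :* (n :+ s)) refl N s ⟩
      (N + s * s) - (s - N) * (N + s)
        ≈⟨ +-cong (trans (+-congˡ (sym (sumOver-square {X = D} e (ℕ.≤-reflexive |D|≡1)))) N+ΣDe²≈0)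
                  (-‿cong (*-congˡ N+ΣDe≈0)) ⟩
      0# - (s - N) * 0#            ≈⟨ solve 2 (λ s n → con 0ℤ :- (s :- n) :* con 0ℤ := con 0ℤ) refl s N ⟩
      0#                           ∎))
      where
      s : Carrier
      s = sumOver D e
      1+N≉0 : ¬ 1# + N ≈ 0#
      1+N≉0 = ·1≉0 z<s (ℕ.s≤s (ℕ.≤-trans
        (ℕ.≤-reflexive (≡.trans (ℕ.+-comm 1 (count A)) (≡.cong (count A ℕ.+_) (≡.sym |D|≡1)))) |A|+|D|≤q))
    by-size (suc (suc k)) |D|≡2+k = ℕ.≤-trans (ℕ.+-monoʳ-≤ (count A) (ℕ.s≤s (ℕ.s≤s ℕ.z≤n)))
      (ℕ.≤-reflexive (≡.sym (≡.trans |B|≡|A|+|D| (≡.cong (count A ℕ.+_) |D|≡2+k))))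

  -- The sumsets Sₖ

  S : ℕ → F → Bool
  S zero i = i == Fin.zero
  S (suc k) i = anyᵇ (λ h → μ h ∧ S k (i ⊖ h))

  S-invariant : ∀ k → Invariant (S k)
  S-invariant zero = zero-invariant
  S-invariant (suc k) s i μs S⁺i with anyᵇ-elim (λ h → μ h ∧ S k (i ⊖ h)) S⁺i
  ... | h , μh∧Sk[i⊖h] = anyᵇ-intro (λ h → μ h ∧ S k (s ⊗ i ⊖ h)) (s ⊗ h)
      (≡.cong₂ _∧_ (μ-⊗ {s} {h} μs (∧-conicalˡ (μ h) _ μh∧Sk[i⊖h]))
                   (≡.subst (λ j → S k j ≡ true) (⊗-distribˡ-⊖ s i h)
                            (S-invariant k s (i ⊖ h) μs (∧-conicalʳ (μ h) _ μh∧Sk[i⊖h]))))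

  S-step : ∀ k i → S k (i ⊖ one) ≡ true → S (suc k) i ≡ true
  S-step k i Sk[i⊖1] = anyᵇ-intro (λ h → μ h ∧ S k (i ⊖ h)) one (≡.cong₂ _∧_ μ-one Sk[i⊖1])

  S-fin : ∀ k → S k (fin k) ≡ true
  S-fin zero = ≡.subst (λ j → (j == Fin.zero) ≡ true) (≡.sym (e-injective {fin 0} {Fin.zero} (e-fin 0))) (==-refl {suc q} Fin.zero)
  S-fin (suc k) = S-step k (fin (suc k)) (≡.subst (λ j → S k j ≡ true) (≡.sym fin[1+k]⊖1≡fin[k]) (S-fin k))
    where
    fin[1+k]⊖1≡fin[k] : fin (suc k) ⊖ one ≡ fin k
    fin[1+k]⊖1≡fin[k] = e-injective (begin
      e (fin (suc k) ⊖ one)   ≈⟨ trans (e-⊖ (fin (suc k)) one) (+-cong (e-fin (suc k)) (-‿cong e-one)) ⟩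
      (1# + k · 1#) - 1#      ≈⟨ solve 1 (λ x → (con 1ℤ :+ x) :- con 1ℤ := x) refl (k · 1#) ⟩
      k · 1#                  ≈⟨ e-fin k ⟨
      e (fin k)               ∎)

  S* : ℕ → F → Bool
  S* k i = S k i ∧ NZ i

  S*-invariant : ∀ k → Invariant (S* k)
  S*-invariant k = invariant-∖ (S k) (_== Fin.zero) (S-invariant k) zero-invariant

  |μ|∣|S*| : ∀ k → count μ ∣ count (S* k)
  |μ|∣|S*| k = |μ|∣count (S* k) (S*-invariant k) (∧-zeroʳ (S k Fin.zero))

  |S|≤1+|S*| : ∀ k → count (S k) ≤ suc (count (S* k))
  |S|≤1+|S*| k = ℕ.≤-trans (ℕ.≤-reflexive (count-split (S k) (_== Fin.zero)))
    (ℕ.+-monoˡ-≤ (count (S* k)) (ℕ.≤-trans (count-mono {Y = _== Fin.zero} (λ i → ∧-conicalʳ (S k i) _))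
                                             (ℕ.≤-reflexive (count-== {suc q} Fin.zero))))

  |S*|≤|S| : ∀ k → count (S* k) ≤ count (S k)
  |S*|≤|S| k = count-mono {X = S* k} (λ i → ∧-conicalˡ (S k i) _)

  S*-grows : ∀ k w → S (suc k) w ≡ false → count (S* k) ℕ.+ count μ ≤ count (S* (suc k))
  S*-grows k w S⁺w≡false = +-next-multiple (|μ|∣|S*| k) (|μ|∣|S*| (suc k)) (ℕ.≤-pred (ℕ.≤-trans
    (ℕ.s≤s (ℕ.s≤s (|S*|≤|S| k)))
    (ℕ.≤-trans (ℕ.≤-reflexive (ℕ.+-comm 2 (count (S k))))
    (ℕ.≤-trans (growth (S k) (S (suc k)) (S-invariant k) (S-invariant (suc k)) (S-step k)
                       (∈⇒count>0 {X = S k} (S-fin k)) |S⁺|≤q)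
               (|S|≤1+|S*| (suc k))))))
    where
    |S⁺|≤q : count (S (suc k)) ≤ q
    |S⁺|≤q = ℕ.≤-trans (count-mono {Y = λ i → not (i == w)} S⁺⊆≢w) (ℕ.≤-reflexive (count-≢ w))
      where
      S⁺⊆≢w : ∀ i → S (suc k) i ≡ true → not (i == w) ≡ true
      S⁺⊆≢w i S⁺i = ≡.cong not (≢⇒==false i≢w)
        where
        i≢w : i ≢ w
        i≢w ≡.refl with () ← ≡.trans (≡.sym S⁺w≡false) S⁺i

  S*-lower-bound : ∀ k → (k ℕ.* count μ) ℕ.⊓ q ≤ count (S* k)
  S*-lower-bound zero = ℕ.z≤n
  S*-lower-bound (suc k) with count (λ i → NZ i ∧ not (S (suc k) i)) ℕ.≟ 0
  ... | yes none-missing = ℕ.≤-trans (ℕ.m⊓n≤n _ q) (ℕ.≤-trans (ℕ.≤-reflexive (≡.sym count-NZ)) (count-mono {X = NZ} NZ⊆S*))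
    where
    NZ⊆S* : ∀ i → NZ i ≡ true → S* (suc k) i ≡ true
    NZ⊆S* i NZi with S (suc k) i | count≡0⇒∉ {X = λ i → NZ i ∧ not (S (suc k) i)} none-missing i
    ... | true  | _ = NZi
    ... | false | NZi∧true≡false with () ← ≡.trans (≡.sym NZi∧true≡false) (≡.trans (∧-identityʳ (NZ i)) NZi)
  ... | no some-missing with count>0⇒∈ (λ i → NZ i ∧ not (S (suc k) i)) (ℕ.n≢0⇒n>0 some-missing)
  ...   | w , NZw∧¬S⁺w = ℕ.≤-trans (+-⊓-≤ (count μ) (k ℕ.* count μ) q)
          (ℕ.≤-trans (ℕ.≤-reflexive (ℕ.+-comm (count μ) _))
          (ℕ.≤-trans (ℕ.+-monoˡ-≤ (count μ) (S*-lower-bound k))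
                     (S*-grows k w (not-injective (∧-conicalʳ (NZ w) _ NZw∧¬S⁺w)))))

  S*-full : ∀ k → q ≤ count (S* k) → ∀ i → i ≢ Fin.zero → S k i ≡ true
  S*-full k q≤|S*| i i≢0 with S k i in Ski
  ... | true = ≡.refl
  ... | false = ⊥-elim (ℕ.1+n≰n (ℕ.≤-trans (ℕ.≤-reflexive (≡.trans (≡.sym (count-remove {X = NZ} {i} NZi)) count-NZ))
                                          (ℕ.≤-trans q≤|S*| (count-mono {X = S* k} {Y = λ j → NZ j ∧ not (j == i)} S*⊆NZ∖i))))
    where
    NZi : NZ i ≡ true
    NZi = ≡.cong not (≢⇒==false i≢0)
    S*⊆NZ∖i : ∀ j → S* k j ≡ true → (NZ j ∧ not (j == i)) ≡ true
    S*⊆NZ∖i j S*j = ≡.cong₂ _∧_ (∧-conicalʳ (S k j) _ S*j) (≡.cong not (≢⇒==false j≢i))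
      where
      j≢i : j ≢ i
      j≢i ≡.refl with () ← ≡.trans (≡.sym Ski) (∧-conicalˡ (S k j) _ S*j)

  zero∈S : ∀ k → suc d ≤ k → S (suc k) Fin.zero ≡ true
  zero∈S k d₀≤k = S-step k Fin.zero (≡.subst (λ j → S k j ≡ true) (≡.sym 0⊖1≡-1) (S*-full k q≤|S*| minus-one -1≢0))
    where
    q≤|S*| : q ≤ count (S* k)
    q≤|S*| = ℕ.≤-trans (ℕ.≤-reflexive (≡.sym (ℕ.m≥n⇒m⊓n≡n q≤k|μ|))) (S*-lower-bound k)
      where
      q≤k|μ| : q ≤ k ℕ.* count μ
      q≤k|μ| = ℕ.≤-trans (ℕ.≤-reflexive (≡.sym d₀m₀≡q)) (ℕ.*-mono-≤ d₀≤k m₀≤|μ|)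
    0⊖1≡-1 : Fin.zero ⊖ one ≡ minus-one
    0⊖1≡-1 = e-injective (trans (e-⊖ Fin.zero one) (trans (trans (+-identityˡ _) (-‿cong e-one)) (sym e-minus-one)))
    -1≢0 : minus-one ≢ Fin.zero
    -1≢0 -1≡0 = 1≉0 (-‿injective (trans (trans (sym e-minus-one) (reflexive (≡.cong e -1≡0))) (sym -0#≈0#)))

  sum-of-roots : ∀ n i → S n i ≡ true → ∃ λ (α : Fin n → Carrier) → (∀ j → α j ^ m₀ ≈ 1#) × sum α ≈ e i
  sum-of-roots zero i S0i = (λ ()) , (λ ()) , reflexive (≡.cong e (≡.sym (==⇒≡ {i = i} {j = Fin.zero} S0i)))
  sum-of-roots (suc n) i S⁺i with anyᵇ-elim (λ h → μ h ∧ S n (i ⊖ h)) S⁺i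
  ... | h , μh∧Sn[i⊖h] with sum-of-roots n (i ⊖ h) (∧-conicalʳ (μ h) _ μh∧Sn[i⊖h])
  ...   | α , α^m₀≈1 , Σα≈e[i⊖h] = e h ∷ α , roots , (begin
      e h + sum α          ≈⟨ +-congˡ (trans Σα≈e[i⊖h] (e-⊖ i h)) ⟩
      e h + (e i - e h)    ≈⟨ solve 2 (λ x y → x :+ (y :- x) := y) refl (e h) (e i) ⟩
      e i                  ∎)
    where
    roots : ∀ j → (e h ∷ α) j ^ m₀ ≈ 1#
    roots Fin.zero = μ-sound (∧-conicalˡ (μ h) _ μh∧Sn[i⊖h])
    roots (Fin.suc j) = α^m₀≈1 j

  vanishing-sums : ∀ n → suc d < n → ∃ λ (α : Fin n → Carrier) → (∀ j → α j ^ m₀ ≈ 1#) × sum α ≈ 0#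
  vanishing-sums (suc k) (ℕ.s≤s d₀≤k) = sum-of-roots (suc k) Fin.zero (zero∈S k d₀≤k)

open import Data.Nat.Base using (_+_; _*_; _∸_)
open import Data.Nat.Primality using (¬prime[0]; ¬prime[1])
open import Data.Nat.Coprimality using (Coprime)
open import Data.Nat.GCD using (gcd; gcd[m,n]∣n)

algebraic-closure⇒field : ∀ {p K} → IsAlgClosureOfFp p K → IsFieldOfCharacteristic p K
algebraic-closure⇒field K-closure = record
  { isField = record { 1≉0 = nontrivial ; inverse = inverses }
  ; char    = characteristic
  }
  where open IsAlgClosureOfFp K-closure

InW-∣ : (K : CommutativeRing 0ℓ 0ℓ) → ∀ {a b} → a ∣ b → ∀ n → InW K a n → InW K b n
InW-∣ K a∣b n (α , α^a≈1 , Σα≈0) = α , (λ i → Exponentiation.^≈1-∣ K a∣b (α^a≈1 i)) , Σα≈0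

theorem3p1 : (p m : ℕ) → Prime p → 1 ≤ m → Coprime p m →
    3 ≤ gcd (p ∸ 1) m →
    (d₀ : ℕ) → d₀ * gcd (p ∸ 1) m ≡ p ∸ 1 →
    (K : CommutativeRing 0ℓ 0ℓ) → IsAlgClosureOfFp p K →
    (∀ n → d₀ + 1 ≤ n → InW K (gcd (p ∸ 1) m) n) ×
    (∀ n → InW K (gcd (p ∸ 1) m) n → InW K m n)
theorem3p1 zero _ p-prime = ⊥-elim (¬prime[0] p-prime)
theorem3p1 (suc q) m p-prime _ _ _ zero 0≡q _ _ = ⊥-elim (¬prime[1] (≡.subst (λ r → Prime (suc r)) (≡.sym 0≡q) p-prime))
theorem3p1 (suc q) m p-prime _ _ 3≤m₀ (suc d) d₀m₀≡q K K-closure = vanishing , InW-∣ K (gcd[m,n]∣n q m)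
  where
  open VanishingSumsOfRootsOfUnity K q p-prime (algebraic-closure⇒field K-closure) (gcd q m) d 3≤m₀ d₀m₀≡q
    using (vanishing-sums)
  vanishing : ∀ n → suc d + 1 ≤ n → InW K (gcd q m) n
  vanishing n d₀+1≤n = vanishing-sums n (≡.subst (_≤ n) (ℕ.+-comm (suc d) 1) d₀+1≤n)
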